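{- Let $(f,a),(g,b)\in\mathcal{IS}_d\wr_p\mathcal{IS}_d$. Then: (1) $(f,a)\,\mathcal L\,(g,b)$ if and only if $\mathrm{ran}(a)=\mathrm{ran}(b)$ and $\mathrm{ran}(f^{a^{ -1}}(z))=\mathrm{ran}(g^{b^{ -1}}(z))$ for all $z\in\mathrm{ran}(a)$; (2) $(f,a)\,\mathcal R\,(g,b)$ if and only if $\mathrm{dom}(a)=\mathrm{dom}(b)$ and $\mathrm{dom}(f(z))=\mathrm{dom}(g(z))$ for all $z\in\mathrm{dom}(a)$; (3) $(f,a)\,\mathcal H\,(g,b)$ if and only if $\mathrm{ran}(a)=\mathrm{ran}(b)$, $\mathrm{dom}(a)=\mathrm{dom}(b)$, $\mathrm{ran}(f^{a^{ -1}}(z))=\mathrm{ran}(g^{b^{ -1}}(z))$ for all $z\in\mathrm{ran}(a)$, and $\mathrm{dom}(f(z))=\mathrm{dom}(g(z))$ for all $z\in\mathrm{dom}(a)$.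
   Context: $\mathcal{IS}_d$ is the semigroup of all injective partial maps of $N_d=\{1,\dots,d\}$ (including the empty map), written on the right, $x(ab)=(xa)b$, with domain $\mathrm{dom}$, range $\mathrm{ran}$, and $a^{ -1}$ the inverse partial map. $F(N_d,\mathcal{IS}_d)$ is the set of functions $f$ from a subset $\mathrm{dom}(f)\subseteq N_d$ to $\mathcal{IS}_d$ with $\mathrm{dom}(fg)=\mathrm{dom}(f)\cap\mathrm{dom}(g)$, $(fg)(x)=f(x)g(x)$; for $a\in\mathcal{IS}_d$, $\mathrm{dom}(f^a)=\{x\in\mathrm{dom}(a):xa\in\mathrm{dom}(f)\}$, $f^a(x)=f(xa)$. The partial wreath square is $\mathcal{IS}_d\wr_p\mathcal{IS}_d=\{(f,a)\in F(N_d,\mathcal{IS}_d)\times\mathcal{IS}_d:\mathrm{dom}(f)=\mathrm{dom}(a)\}$ with $(f,a)(g,b)=(fg^a,ab)$. $\mathcal L,\mathcal R,\mathcal H$ are Green's relations. -}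

module Defs where

open import Data.Nat using (ℕ; zero; suc)
open import Data.Fin using (Fin; zero; suc; _≟_)
open import Data.Maybe using (Maybe; just; nothing; _>>=_)
import Data.Maybe as Maybe
open import Data.Maybe.Relation.Binary.Pointwise using (Pointwise)
open import Data.Product using (Σ; ∃; _×_; _,_; proj₁; proj₂)
open import Data.Sum using (_⊎_)
open import Data.Empty using (⊥)
open import Relation.Nullary using (yes; no)
open import Relation.Binary.PropositionalEquality
  using (_≡_; refl; sym; trans; cong; subst)

-- N_d = Fin d.  Injective partial maps of N_d (written on the right):
-- x a = fun a x  (nothing = undefined).

record IS (d : ℕ) : Set where
  constructor mkIS
  field
    fun : Fin d → Maybe (Fin d)
    inj : ∀ {x y z} → fun x ≡ just z → fun y ≡ just z → x ≡ y
open IS public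

dom : ∀ {d} → IS d → Fin d → Set
dom a x = ∃ λ y → fun a x ≡ just y

ran : ∀ {d} → IS d → Fin d → Set
ran a y = ∃ λ x → fun a x ≡ just y

_≐_ : ∀ {d} → (Fin d → Set) → (Fin d → Set) → Set
P ≐ Q = ∀ x → (P x → Q x) × (Q x → P x)

bind-just : ∀ {A B : Set} (m : Maybe A) (k : A → Maybe B) {z : B} →
            (m >>= k) ≡ just z → ∃ λ y → (m ≡ just y) × (k y ≡ just z)
bind-just (just y) k p = y , refl , p

_⨾_ : ∀ {d} → IS d → IS d → IS d
fun (a ⨾ b) x = fun a x >>= fun b
inj (_⨾_ a b) {x} {y} p q
  with bind-just (fun a x) (fun b) p | bind-just (fun a y) (fun b) q
... | u , ax , bu | v , ay , bv with inj b bu bv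
... | refl = inj a ax ay

findPre : ∀ {d} n → (Fin n → Maybe (Fin d)) → Fin d → Maybe (Fin n)
findPre zero g z = nothing
findPre (suc n) g z with g zero
... | nothing = Maybe.map suc (findPre n (λ i → g (suc i)) z)
... | just w with w ≟ z
...   | yes _ = just zero
...   | no _ = Maybe.map suc (findPre n (λ i → g (suc i)) z)

map-suc-just : ∀ {n} (m : Maybe (Fin n)) {x : Fin (suc n)} →
               Maybe.map suc m ≡ just x → ∃ λ i → (m ≡ just i) × (x ≡ suc i)
map-suc-just (just i) refl = i , refl , refl

findPre-sound : ∀ {d} n (g : Fin n → Maybe (Fin d)) z {x} →
                findPre n g z ≡ just x → g x ≡ just z
findPre-sound zero g z ()
findPre-sound (suc n) g z {x} p with g zero in eq
... | nothing with map-suc-just (findPre n (λ i → g (suc i)) z) p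
...   | i , q , refl = findPre-sound n (λ i → g (suc i)) z q
findPre-sound (suc n) g z {x} p | just w with w ≟ z
...   | yes refl with p
...     | refl = eq
findPre-sound (suc n) g z {x} p | just w | no _
  with map-suc-just (findPre n (λ i → g (suc i)) z) p
...   | i , q , refl = findPre-sound n (λ i → g (suc i)) z q

just-inj : ∀ {A : Set} {x y : A} → just x ≡ just y → x ≡ y
just-inj refl = refl

inv : ∀ {d} → IS d → IS d
fun (inv {d} a) z = findPre d (fun a) z
inj (inv {d} a) {x} {y} p q =
  just-inj (trans (sym (findPre-sound d (fun a) x p)) (findPre-sound d (fun a) y q))

F : ℕ → Set
F d = Fin d → Maybe (IS d)

domF : ∀ {d} → F d → Fin d → Set
domF f x = ∃ λ h → f x ≡ just h

mulM : ∀ {d} → Maybe (IS d) → Maybe (IS d) → Maybe (IS d)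
mulM (just h) (just k) = just (h ⨾ k)
mulM _ _ = nothing

_·F_ : ∀ {d} → F d → F d → F d
(f ·F g) x = mulM (f x) (g x)

_^_ : ∀ {d} → F d → IS d → F d
(f ^ a) x = fun a x >>= f

domM : ∀ {d} → Maybe (IS d) → Fin d → Set
domM (just h) = dom h
domM nothing = λ _ → ⊥

ranM : ∀ {d} → Maybe (IS d) → Fin d → Set
ranM (just h) = ran h
ranM nothing = λ _ → ⊥

record W (d : ℕ) : Set where
  constructor ⟨_,_,_⟩
  field
    fst   : F d
    snd   : IS d
    domEq : ∀ x → (domF fst x → dom snd x) × (dom snd x → domF fst x)
open W public

mulM-just : ∀ {d} (m n : Maybe (IS d)) {h} → mulM m n ≡ just h →
            (∃ λ h₁ → m ≡ just h₁) × (∃ λ h₂ → n ≡ just h₂)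
mulM-just (just h₁) (just h₂) p = (h₁ , refl) , (h₂ , refl)

mulM-def : ∀ {d} {m n : Maybe (IS d)} {h₁ h₂} → m ≡ just h₁ → n ≡ just h₂ →
           ∃ λ h → mulM m n ≡ just h
mulM-def {h₁ = h₁} {h₂} refl refl = (h₁ ⨾ h₂) , refl

_*_ : ∀ {d} → W d → W d → W d
fst (s * t) = fst s ·F (fst t ^ snd s)
snd (s * t) = snd s ⨾ snd t
domEq (s * t) x = forward , backward
  where
  forward : domF (fst s ·F (fst t ^ snd s)) x → dom (snd s ⨾ snd t) x
  forward (h , p) with mulM-just (fst s x) ((fst t ^ snd s) x) p
  ... | _ , (h₂ , q) with bind-just (fun (snd s) x) (fst t) q
  ... | u , ax , gu with proj₁ (domEq t u) (h₂ , gu)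
  ... | v , bu = v , subst (λ m → (m >>= fun (snd t)) ≡ just v) (sym ax) bu
  backward : dom (snd s ⨾ snd t) x → domF (fst s ·F (fst t ^ snd s)) x
  backward (v , p) with bind-just (fun (snd s) x) (fun (snd t)) p
  ... | u , ax , bu with proj₂ (domEq t u) (v , bu) | proj₂ (domEq s x) (u , ax)
  ... | (k , gu) | (h , fx) =
    mulM-def fx (subst (λ m → (m >>= fst t) ≡ just k) (sym ax) gu)

_≈IS_ : ∀ {d} → IS d → IS d → Set
a ≈IS b = ∀ x → fun a x ≡ fun b x

_≈_ : ∀ {d} → W d → W d → Set
s ≈ t = (∀ x → Pointwise _≈IS_ (fst s x) (fst t x)) × (snd s ≈IS snd t)

-- Green's relations: s L t iff S¹s = S¹t, s R t iff sS¹ = tS¹, H = L ∩ R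

_≤L_ : ∀ {d} → W d → W d → Set
s ≤L t = (s ≈ t) ⊎ (∃ λ u → s ≈ (u * t))

_≤R_ : ∀ {d} → W d → W d → Set
s ≤R t = (s ≈ t) ⊎ (∃ λ u → s ≈ (t * u))

GreenL : ∀ {d} → W d → W d → Set
GreenL s t = (s ≤L t) × (t ≤L s)

GreenR : ∀ {d} → W d → W d → Set
GreenR s t = (s ≤R t) × (t ≤R s)

GreenH : ∀ {d} → W d → W d → Set
GreenH s t = GreenL s t × GreenR s t

{-# OPTIONS --safe #-}

-- In IS_d, a is a left multiple of b iff ran a ⊆ ran b, since then a = (a b⁻¹) b, and a
-- right multiple iff dom a ⊆ dom b, since then a = b (b⁻¹ a). In the wreath square the same
-- factorisations, applied to the top map a and to every fibre f(x), produce explicit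
-- quotients: (f,a) = (f · ((g^(a b⁻¹))⁻¹), a b⁻¹) (g,b) when ran a ⊆ ran b and the fibres
-- over ran a have ranges inside those of g, and dually (f,a) = (g,b) ((g⁻¹ f)^(b⁻¹), b⁻¹ a)
-- for domains. Conversely, multiplying on the left (right) can only shrink ranges (domains),
-- both of the top map and of the fibres. Symmetrising these descriptions of ≤L and ≤R gives
-- L and R, and H = L ∩ R.

module Submission where

open import Defs
open import Data.Nat using (ℕ; suc)
open import Data.Fin using (Fin; zero; suc; _≟_)
open import Data.Maybe using (Maybe; just; nothing; _>>=_)
import Data.Maybe as Maybe
open import Data.Maybe.Properties using (just-injective)
open import Data.Maybe.Relation.Binary.Pointwise using (Pointwise; just; nothing)
open import Data.Product using (∃; _×_; _,_; proj₁; proj₂)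
open import Data.Product.Function.NonDependent.Propositional using (_×-⇔_)
open import Data.Sum using (inj₁; inj₂)
open import Function using (_∘_)
open import Function.Bundles using (_⇔_; mk⇔)
import Function.Properties.Equivalence as ⇔
open import Level using (0ℓ)
open import Relation.Binary.PropositionalEquality
open import Relation.Nullary using (yes; no; contradiction)
open import Relation.Unary using (Pred; _⊆_)

private variable
  d : ℕ

findPre-complete : ∀ n (g : Fin n → Maybe (Fin d)) {z x} → g x ≡ just z →
                   ∃ λ x′ → findPre n g z ≡ just x′
findPre-complete (suc n) g gx with g zero in g0
findPre-complete (suc n) g {x = zero}  gx | nothing with () ← trans (sym g0) gx
findPre-complete (suc n) g {x = suc x} gx | nothing
  with x′ , p ← findPre-complete n (λ i → g (suc i)) gx = suc x′ , cong (Maybe.map suc) p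
findPre-complete (suc n) g {z} gx | just w with w ≟ z
... | yes _ = zero , refl
findPre-complete (suc n) g {x = zero} gx | just w | no w≢z =
  contradiction (just-injective (trans (sym g0) gx)) w≢z
findPre-complete (suc n) g {x = suc x} gx | just w | no _
  with x′ , p ← findPre-complete n (λ i → g (suc i)) gx = suc x′ , cong (Maybe.map suc) p

inv-complete : (a : IS d) {x z : Fin d} → fun a x ≡ just z → fun (inv a) z ≡ just x
inv-complete {d} a ax with x′ , p ← findPre-complete d (fun a) ax =
  trans p (cong just (inj a (findPre-sound d (fun a) _ p) ax))

inv-sound : (a : IS d) {x z : Fin d} → fun (inv a) z ≡ just x → fun a x ≡ just z
inv-sound {d} a = findPre-sound d (fun a) _

ran-⨾ : (a b : IS d) → ran (a ⨾ b) ⊆ ran b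
ran-⨾ a b (x , abx) with y , _ , by ← bind-just (fun a x) (fun b) abx = y , by

dom-⨾ : (a b : IS d) → dom (a ⨾ b) ⊆ dom a
dom-⨾ a b {x} (z , abx) with y , ax , _ ← bind-just (fun a x) (fun b) abx = y , ax

⨾-inv-just : (a b : IS d) {x y z : Fin d} →
             fun a x ≡ just z → fun b y ≡ just z → fun (a ⨾ inv b) x ≡ just y
⨾-inv-just a b ax by = trans (cong (_>>= fun (inv b)) ax) (inv-complete b by)

factorThroughRan : (a b : IS d) → ran a ⊆ ran b → a ≈IS ((a ⨾ inv b) ⨾ b)
factorThroughRan a b ran⊆ x with fun a x in ax
... | nothing = refl
... | just z with y , by ← ran⊆ (x , ax) =
  sym (trans (cong (_>>= fun b) (inv-complete b by)) by)

factorThroughDom : (a b : IS d) → dom a ⊆ dom b → a ≈IS (b ⨾ (inv b ⨾ a))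
factorThroughDom a b dom⊆ x with fun b x in bx
... | just y = sym (cong (_>>= fun a) (inv-complete b bx))
... | nothing with fun a x in ax
...   | nothing = refl
...   | just z with () ← trans (sym bx) (proj₂ (dom⊆ (z , ax)))

ranM-mulM : (m n : Maybe (IS d)) → ranM (mulM m n) ⊆ ranM n
ranM-mulM (just a) (just b) r = ran-⨾ a b r
ranM-mulM (just _) nothing ()
ranM-mulM nothing _ ()

domM-mulM : (m n : Maybe (IS d)) → domM (mulM m n) ⊆ domM m
domM-mulM (just a) (just b) r = dom-⨾ a b r
domM-mulM (just _) nothing ()
domM-mulM nothing _ ()

ranM-≡⊆ : {m n : Maybe (IS d)} → m ≡ n → ranM m ⊆ ranM n
ranM-≡⊆ refl r = r

domM-≡⊆ : {m n : Maybe (IS d)} → m ≡ n → domM m ⊆ domM n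
domM-≡⊆ refl r = r

ranM-cong : {m n : Maybe (IS d)} → Pointwise _≈IS_ m n → ranM m ⊆ ranM n
ranM-cong (just a≈b) (x , ax) = x , trans (sym (a≈b x)) ax

domM-cong : {m n : Maybe (IS d)} → Pointwise _≈IS_ m n → domM m ⊆ domM n
domM-cong (just a≈b) {x} (y , ax) = y , trans (sym (a≈b x)) ax

factorThroughRanM : (m n : Maybe (IS d)) →
                    (∀ {a} → m ≡ just a → ∃ λ b → n ≡ just b × ran a ⊆ ran b) →
                    Pointwise _≈IS_ m (mulM (mulM m (Maybe.map inv n)) n)
factorThroughRanM nothing n _ = nothing
factorThroughRanM (just a) n hyp with b , refl , ran⊆ ← hyp refl =
  just (factorThroughRan a b ran⊆)

factorThroughDomM : (m n : Maybe (IS d)) →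
                    (∀ {a} → m ≡ just a → ∃ λ b → n ≡ just b × dom a ⊆ dom b) →
                    Pointwise _≈IS_ m (mulM n (mulM (Maybe.map inv n) m))
factorThroughDomM nothing nothing _ = nothing
factorThroughDomM nothing (just _) _ = nothing
factorThroughDomM (just a) n hyp with b , refl , dom⊆ ← hyp refl =
  just (factorThroughDom a b dom⊆)

^-inv-just : (f : F d) (a : IS d) {x z : Fin d} → fun a x ≡ just z → (f ^ inv a) z ≡ f x
^-inv-just f a ax = cong (_>>= f) (inv-complete a ax)

^-inv-^ : (f : F d) (a : IS d) → (∀ {x} → domF f x → dom a x) →
          ∀ x → ((f ^ inv a) ^ a) x ≡ f x
^-inv-^ f a domf⊆ x with fun a x in ax
... | just z = ^-inv-just f a ax
... | nothing with f x in fx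
...   | nothing = refl
...   | just h with () ← trans (sym ax) (proj₂ (domf⊆ (h , fx)))

Fibred⊆ : (A : Pred (Fin d) 0ℓ) (P : Fin d → Pred (Fin d) 0ℓ)
          (B : Pred (Fin d) 0ℓ) (Q : Fin d → Pred (Fin d) 0ℓ) → Set
Fibred⊆ A P B Q = A ⊆ B × (∀ {z} → A z → P z ⊆ Q z)

Fibred≐ : (A : Pred (Fin d) 0ℓ) (P : Fin d → Pred (Fin d) 0ℓ)
          (B : Pred (Fin d) 0ℓ) (Q : Fin d → Pred (Fin d) 0ℓ) → Set
Fibred≐ A P B Q = (A ≐ B) × (∀ z → A z → P z ≐ Q z)

Fibred⊆-trans : {A B C : Pred (Fin d) 0ℓ} {P Q R : Fin d → Pred (Fin d) 0ℓ} →
                Fibred⊆ A P B Q → Fibred⊆ B Q C R → Fibred⊆ A P C R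
Fibred⊆-trans (A⊆B , P⊆Q) (B⊆C , Q⊆R) = B⊆C ∘ A⊆B , λ Az → Q⊆R (A⊆B Az) ∘ P⊆Q Az

Fibred⊆-antisym⇔ : {A B : Pred (Fin d) 0ℓ} {P Q : Fin d → Pred (Fin d) 0ℓ} →
                   (Fibred⊆ A P B Q × Fibred⊆ B Q A P) ⇔ Fibred≐ A P B Q
Fibred⊆-antisym⇔ = mk⇔
  (λ ((A⊆B , P⊆Q) , (B⊆A , Q⊆P)) →
     (λ _ → A⊆B , B⊆A) , λ _ Az _ → P⊆Q Az , Q⊆P (A⊆B Az))
  (λ (A≐B , P≐Q) →
     (proj₁ (A≐B _) , λ Az → proj₁ (P≐Q _ Az _)) ,
     (proj₂ (A≐B _) , λ Bz → proj₂ (P≐Q _ (proj₂ (A≐B _) Bz) _)))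

ranFibre : W d → Fin d → Pred (Fin d) 0ℓ
ranFibre s z = ranM ((fst s ^ inv (snd s)) z)

domFibre : W d → Fin d → Pred (Fin d) 0ℓ
domFibre s z = domM (fst s z)

_⊑L_ : W d → W d → Set
s ⊑L t = Fibred⊆ (ran (snd s)) (ranFibre s) (ran (snd t)) (ranFibre t)

_⊑R_ : W d → W d → Set
s ⊑R t = Fibred⊆ (dom (snd s)) (domFibre s) (dom (snd t)) (domFibre t)

≈⇒⊑L : (s t : W d) → s ≈ t → s ⊑L t
≈⇒⊑L s t (f≈g , a≈b) = ran⊆ , fibre
  where
  ran⊆ : ran (snd s) ⊆ ran (snd t)
  ran⊆ (x , ax) = x , trans (sym (a≈b x)) ax
  fibre : ∀ {z} → ran (snd s) z → ranFibre s z ⊆ ranFibre t z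
  fibre (x , ax) =
    ranM-≡⊆ (sym (^-inv-just (fst t) (snd t) (trans (sym (a≈b x)) ax)))
    ∘ ranM-cong (f≈g x)
    ∘ ranM-≡⊆ (^-inv-just (fst s) (snd s) ax)

≈⇒⊑R : (s t : W d) → s ≈ t → s ⊑R t
≈⇒⊑R _ _ (f≈g , a≈b) = (λ {x} (y , ax) → y , trans (sym (a≈b x)) ax) , λ {x} _ → domM-cong (f≈g x)

*-⊑L : (u t : W d) → (u * t) ⊑L t
*-⊑L u t = ran-⨾ (snd u) (snd t) , fibre
  where
  fibre : ∀ {z} → ran (snd (u * t)) z → ranFibre (u * t) z ⊆ ranFibre t z
  fibre (x , ctx) with y , cx , ty ← bind-just (fun (snd u) x) (fun (snd t)) ctx =
    ranM-≡⊆ (sym (^-inv-just (fst t) (snd t) ty))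
    ∘ ranM-≡⊆ (cong (_>>= fst t) cx)
    ∘ ranM-mulM (fst u x) ((fst t ^ snd u) x)
    ∘ ranM-≡⊆ (^-inv-just (fst (u * t)) (snd (u * t)) ctx)

*-⊑R : (t u : W d) → (t * u) ⊑R t
*-⊑R t u = dom-⨾ (snd t) (snd u) , λ {x} _ → domM-mulM (fst t x) ((fst u ^ snd t) x)

≤L⇒⊑L : (s t : W d) → s ≤L t → s ⊑L t
≤L⇒⊑L s t (inj₁ s≈t) = ≈⇒⊑L s t s≈t
≤L⇒⊑L s t (inj₂ (u , s≈ut)) = Fibred⊆-trans (≈⇒⊑L s (u * t) s≈ut) (*-⊑L u t)

≤R⇒⊑R : (s t : W d) → s ≤R t → s ⊑R t
≤R⇒⊑R s t (inj₁ s≈t) = ≈⇒⊑R s t s≈t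
≤R⇒⊑R s t (inj₂ (u , s≈tu)) = Fibred⊆-trans (≈⇒⊑R s (t * u) s≈tu) (*-⊑R t u)

invF : F d → F d
invF f x = Maybe.map inv (f x)

leftQuotient : (s t : W d) → ran (snd s) ⊆ ran (snd t) → W d
leftQuotient {d} s t ran⊆ = ⟨ h , c , (λ x → domh⇒domc x , domc⇒domh x) ⟩
  where
  c : IS d
  c = snd s ⨾ inv (snd t)
  h : F d
  h = fst s ·F invF (fst t ^ c)
  domh⇒domc : ∀ x → domF h x → dom c x
  domh⇒domc x (_ , hx)
    with (_ , sx) , _ ← mulM-just (fst s x) _ hx
    with z , ax ← proj₁ (domEq s x) (_ , sx)
    with y , by ← ran⊆ (x , ax) = y , ⨾-inv-just (snd s) (snd t) ax by
  domc⇒domh : ∀ x → dom c x → domF h x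
  domc⇒domh x (y , cx)
    with z , ax , b⁻¹z ← bind-just (fun (snd s) x) (fun (inv (snd t))) cx
    with _ , sx ← proj₂ (domEq s x) (z , ax)
    with _ , ty ← proj₂ (domEq t y) (z , inv-sound (snd t) b⁻¹z) =
    mulM-def sx (cong (Maybe.map inv) (trans (cong (_>>= fst t) cx) ty))

leftQuotient-* : (s t : W d) (s⊑t : s ⊑L t) → s ≈ (leftQuotient s t (proj₁ s⊑t) * t)
leftQuotient-* {d} s t (ran⊆ , fibre⊆) = fst≈ , factorThroughRan a b ran⊆
  where
  a b : IS d
  a = snd s
  b = snd t
  fst≈ : ∀ x → Pointwise _≈IS_ (fst s x) (fst (leftQuotient s t ran⊆ * t) x)
  fst≈ x = factorThroughRanM (fst s x) ((fst t ^ (a ⨾ inv b)) x) factor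
    where
    factor : ∀ {f} → fst s x ≡ just f → ∃ λ g → (fst t ^ (a ⨾ inv b)) x ≡ just g × ran f ⊆ ran g
    factor sx
      with z , ax ← proj₁ (domEq s x) (_ , sx)
      with y , by ← ran⊆ (x , ax)
      with g , ty ← proj₂ (domEq t y) (z , by) =
      g , trans (cong (_>>= fst t) (⨾-inv-just a b ax by)) ty ,
      ranM-≡⊆ (trans (^-inv-just (fst t) b by) ty)
      ∘ fibre⊆ (x , ax)
      ∘ ranM-≡⊆ (sym (trans (^-inv-just (fst s) a ax) sx))

rightQuotient : (s t : W d) → dom (snd s) ⊆ dom (snd t) → W d
rightQuotient {d} s t dom⊆ = ⟨ k ^ inv (snd t) , c , (λ y → domh⇒domc y , domc⇒domh y) ⟩
  where
  c : IS d
  c = inv (snd t) ⨾ snd s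
  k : F d
  k = invF (fst t) ·F fst s
  domh⇒domc : ∀ y → domF (k ^ inv (snd t)) y → dom c y
  domh⇒domc y (_ , hy)
    with z , b⁻¹y , kz ← bind-just (fun (inv (snd t)) y) k hy
    with _ , (_ , sz) ← mulM-just (Maybe.map inv (fst t z)) (fst s z) kz
    with v , az ← proj₁ (domEq s z) (_ , sz) = v , trans (cong (_>>= fun (snd s)) b⁻¹y) az
  domc⇒domh : ∀ y → dom c y → domF (k ^ inv (snd t)) y
  domc⇒domh y (v , cy)
    with z , b⁻¹y , az ← bind-just (fun (inv (snd t)) y) (fun (snd s)) cy
    with _ , sz ← proj₂ (domEq s z) (v , az)
    with _ , tz ← proj₂ (domEq t z) (dom⊆ (v , az))
    with h , kz ← mulM-def (cong (Maybe.map inv) tz) sz = h , trans (cong (_>>= k) b⁻¹y) kz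

rightQuotient-* : (s t : W d) (s⊑t : s ⊑R t) → s ≈ (t * rightQuotient s t (proj₁ s⊑t))
rightQuotient-* {d} s t (dom⊆ , fibre⊆) = fst≈ , factorThroughDom a b dom⊆
  where
  a b : IS d
  a = snd s
  b = snd t
  k : F d
  k = invF (fst t) ·F fst s
  domk⊆domb : ∀ {x} → domF k x → dom b x
  domk⊆domb {x} (_ , kx)
    with _ , (_ , sx) ← mulM-just (Maybe.map inv (fst t x)) (fst s x) kx =
    dom⊆ (proj₁ (domEq s x) (_ , sx))
  factor : ∀ x {f} → fst s x ≡ just f → ∃ λ g → fst t x ≡ just g × dom f ⊆ dom g
  factor x sx
    with ax ← proj₁ (domEq s x) (_ , sx)
    with g , tx ← proj₂ (domEq t x) (dom⊆ ax) =
    g , tx , domM-≡⊆ tx ∘ fibre⊆ ax ∘ domM-≡⊆ (sym sx)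
  fst≈ : ∀ x → Pointwise _≈IS_ (fst s x) (fst (t * rightQuotient s t dom⊆) x)
  fst≈ x = subst (λ m → Pointwise _≈IS_ (fst s x) (mulM (fst t x) m))
                 (sym (^-inv-^ k b domk⊆domb x))
                 (factorThroughDomM (fst s x) (fst t x) (factor x))

≤L⇔⊑L : (s t : W d) → s ≤L t ⇔ s ⊑L t
≤L⇔⊑L s t = mk⇔ (≤L⇒⊑L s t) λ s⊑t → inj₂ (leftQuotient s t (proj₁ s⊑t) , leftQuotient-* s t s⊑t)

≤R⇔⊑R : (s t : W d) → s ≤R t ⇔ s ⊑R t
≤R⇔⊑R s t = mk⇔ (≤R⇒⊑R s t) λ s⊑t → inj₂ (rightQuotient s t (proj₁ s⊑t) , rightQuotient-* s t s⊑t)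

GreenL⇔ : (s t : W d) → GreenL s t ⇔ Fibred≐ (ran (snd s)) (ranFibre s) (ran (snd t)) (ranFibre t)
GreenL⇔ s t = ⇔.trans (≤L⇔⊑L s t ×-⇔ ≤L⇔⊑L t s) Fibred⊆-antisym⇔

GreenR⇔ : (s t : W d) → GreenR s t ⇔ Fibred≐ (dom (snd s)) (domFibre s) (dom (snd t)) (domFibre t)
GreenR⇔ s t = ⇔.trans (≤R⇔⊑R s t ×-⇔ ≤R⇔⊑R t s) Fibred⊆-antisym⇔

×-interchange⇔ : {A B C D : Set} → ((A × B) × (C × D)) ⇔ (A × C × B × D)
×-interchange⇔ = mk⇔ (λ ((a , b) , (c , d)) → a , c , b , d) (λ (a , c , b , d) → (a , b) , (c , d))

mainTheorem6 : ∀ (d : ℕ) (s t : W d) →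
    (GreenL s t ⇔
      ((ran (snd s) ≐ ran (snd t))
       × (∀ z → ran (snd s) z →
            ranM ((fst s ^ inv (snd s)) z) ≐ ranM ((fst t ^ inv (snd t)) z))))
    × (GreenR s t ⇔
      ((dom (snd s) ≐ dom (snd t))
       × (∀ z → dom (snd s) z → domM (fst s z) ≐ domM (fst t z))))
    × (GreenH s t ⇔
      ((ran (snd s) ≐ ran (snd t))
       × (dom (snd s) ≐ dom (snd t))
       × (∀ z → ran (snd s) z →
            ranM ((fst s ^ inv (snd s)) z) ≐ ranM ((fst t ^ inv (snd t)) z))
       × (∀ z → dom (snd s) z → domM (fst s z) ≐ domM (fst t z))))
mainTheorem6 d s t =
  GreenL⇔ s t , GreenR⇔ s t , ⇔.trans (GreenL⇔ s t ×-⇔ GreenR⇔ s t) ×-interchange⇔
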